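{- For $n\geq 1$, $|\hat{\mathcal{B}}_n(321)|=2^{n-1}-n+1$.
   Context: An endofunction of size $n$ is a word $x=x_1\cdots x_n$ with entries in $\{1,\dots,n\}$; it is a Cayley permutation if it contains every integer between $1$ and $\max(x)$. Let $\mathrm{Ascbot}(x)=\{1\}\cup\{i:1\leq i\leq n-1,\ x_i<x_{i+1}\}$ and $\mathrm{Nub}(x)$ the set of indices $i$ such that $x_i$ is the leftmost occurrence of its value. A revised ascent sequence of length $n$ is a Cayley permutation $x$ of length $n$ with $\mathrm{Ascbot}(x)=\mathrm{Nub}(x)$. For Cayley permutations $x$ and $\sigma=\sigma_1\cdots\sigma_k$, $x$ contains $\sigma$ if there are indices $i_1<\cdots<i_k$ such that for all $s,t$: $x_{i_s}<x_{i_t}\iff\sigma_s<\sigma_t$ and $x_{i_s}=x_{i_t}\iff\sigma_s=\sigma_t$; otherwise $x$ avoids $\sigma$. $\hat{\mathcal{B}}_n(\sigma)$ is the set of revised ascent sequences of length $n$ avoiding $\sigma$. -}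

module Defs where

open import Data.Bool using (Bool; true; false; _∧_; _∨_; not; if_then_else_)
open import Data.Nat using (ℕ; zero; suc; _+_; _∸_; _⊔_; _≡ᵇ_; _<ᵇ_)
open import Data.List using (List; []; _∷_; map; concatMap; length; filter; upTo; take; _++_)
open import Data.Bool.ListAction using (all; any)
open import Relation.Nullary.Decidable using (Dec)
open import Data.Bool using (T; T?)

-- Words are lists of natural numbers; positions are 1-indexed and
-- letters take values in {1,…,n}, exactly as in the paper.

range1 : ℕ → List ℕ
range1 m = map suc (upTo m)

wordsOver : ℕ → ℕ → List (List ℕ)
wordsOver n zero    = [] ∷ []
wordsOver n (suc k) = concatMap (λ v → map (v ∷_) (wordsOver n k)) (range1 n)

endofunctions : ℕ → List (List ℕ)
endofunctions n = wordsOver n n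

-- x_i (1-indexed); 0 out of range (never used in range)
at : List ℕ → ℕ → ℕ
at []       _             = 0
at (a ∷ as) zero          = 0
at (a ∷ as) (suc zero)    = a
at (a ∷ as) (suc (suc i)) = at as (suc i)

maxL : List ℕ → ℕ
maxL []       = 0
maxL (a ∷ as) = a ⊔ maxL as

elemᵇ : ℕ → List ℕ → Bool
elemᵇ v xs = any (λ a → a ≡ᵇ v) xs

isCayley : List ℕ → Bool
isCayley x = all (λ v → elemᵇ v x) (range1 (maxL x))

inAscbot : List ℕ → ℕ → Bool
inAscbot x i = (i ≡ᵇ 1) ∨ ((i <ᵇ length x) ∧ (at x i <ᵇ at x (suc i)))

inNub : List ℕ → ℕ → Bool
inNub x i = not (elemᵇ (at x i) (take (i ∸ 1) x))

_⇔ᵇ_ : Bool → Bool → Bool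
true  ⇔ᵇ b = b
false ⇔ᵇ b = not b

ascbotEqNub : List ℕ → Bool
ascbotEqNub x = all (λ i → inAscbot x i ⇔ᵇ inNub x i) (range1 (length x))

isRevisedAscentSeq : List ℕ → Bool
isRevisedAscentSeq x = isCayley x ∧ ascbotEqNub x

subseqs : ℕ → List ℕ → List (List ℕ)
subseqs zero    _        = [] ∷ []
subseqs (suc k) []       = []
subseqs (suc k) (a ∷ as) = map (a ∷_) (subseqs k as) ++ subseqs (suc k) as

orderIso : List ℕ → List ℕ → Bool
orderIso y σ =
  (length y ≡ᵇ length σ) ∧
  all (λ s → all (λ t →
        ((at y s <ᵇ at y t) ⇔ᵇ (at σ s <ᵇ at σ t)) ∧
        ((at y s ≡ᵇ at y t) ⇔ᵇ (at σ s ≡ᵇ at σ t)))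
      (range1 (length σ))) (range1 (length σ))

containsᵇ : List ℕ → List ℕ → Bool
containsᵇ x σ = any (λ y → orderIso y σ) (subseqs (length σ) x)

avoidsᵇ : List ℕ → List ℕ → Bool
avoidsᵇ x σ = not (containsᵇ x σ)

RevAscAvoiding : ℕ → List ℕ → List (List ℕ)
RevAscAvoiding n σ =
  filter (λ x → T? (isRevisedAscentSeq x ∧ avoidsᵇ x σ)) (endofunctions n)

{-# OPTIONS --safe #-}
-- A revised ascent sequence starts with its maximum m. With m in front, avoiding 321 says that the
-- letters below m occur in weakly increasing order; together with Ascbot = Nub and the Cayley
-- condition this forces the shape
--   m m* 1 m* 2 ⋯ m* (m−1) m m* (m−1)*   (m ≥ 2)   or   1 1 ⋯ 1   (m = 1),
-- and these words are the ones accepted by a small automaton. For m ≥ 2 such a word of length n is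
-- determined by the positions of 1, …, m−1 and of the last m among its last n − 1 letters, so there
-- are (n−1 choose m) of them, and 1 + Σ_{m≥2} (n−1 choose m) = 2ⁿ⁻¹ − n + 1.
module Submission where

open import Defs
open import Data.Nat using (ℕ; _≤_; _^_; _∸_; _+_)
open import Data.List using (List; []; _∷_; length)
open import Relation.Binary.PropositionalEquality using (_≡_)

open import Algebra.Properties.CommutativeSemigroup using (interchange)
open import Data.Bool using (Bool; true; false; T; T?; not; _∧_)
open import Data.Bool.ListAction using (all; and)
open import Data.Bool.Properties using (T-∧; T-≡)
open import Data.Empty using (⊥; ⊥-elim)
open import Data.List using (map; upTo; applyUpTo; take; _++_; _∷ʳ_; [_]; filter; concatMap)
open import Data.List.Membership.Propositional using (_∈_; _∉_; find; lose)
open import Data.List.Membership.Propositional.Properties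
  using (∈-++⁺ˡ; ∈-++⁺ʳ; ∈-++⁻; ∈-map⁺; ∈-map⁻; ∈-upTo⁺; ∈-upTo⁻)
open import Data.List.Properties
  using (map-∘; map-cong; map-upTo; map-applyUpTo; ++-assoc; ++-identityʳ; filter-++; length-++; filter-none)
open import Data.List.Relation.Binary.Sublist.Propositional as Sublist using (_⊆_; _∷_; minimum; lookup; from∈)
open import Data.List.Relation.Binary.Sublist.Propositional.Properties using (∷⁻)
open import Data.List.Relation.Unary.All as All using (All; []; _∷_)
import Data.List.Relation.Unary.All.Properties as All
open import Data.List.Relation.Unary.Any as Any using (here; there)
open import Data.List.Relation.Unary.Any.Properties using (any⁺; any⁻)
open import Data.Nat using (zero; suc; pred; _<_; _<ᵇ_; _≡ᵇ_; _≟_; _≤?_; z≤n; s≤s)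
open import Data.List.Membership.DecPropositional _≟_ using (_∈?_)
open import Data.Nat.Combinatorics using (_C_; nC1≡n; nCk+nC[k+1]≡[n+1]C[k+1])
open import Data.Nat.ListAction using (sum)
open import Data.Nat.Properties
  using ( ≤-refl; ≤-trans; ≤-reflexive; ≤-antisym; ≤-pred; <-irrefl; <-trans; ≤-<-trans; <-≤-trans
        ; <⇒≤; <⇒≢; >⇒≢; <⇒≱; ≮⇒≥; ≰⇒>; ≤∧≢⇒<; n≤1+n; n<1+n; m≤n⇒m≤1+n; m≤n⇒m<n∨m≡n
        ; ⊔-lub; m≥n⇒m⊔n≡m; <ᵇ⇒<; <⇒<ᵇ; ≡ᵇ⇒≡; ≡⇒≡ᵇ
        ; +-identityʳ; +-comm; +-assoc; +-suc; m+n∸m≡n; m+n∸n≡m; +-∸-assoc; +-commutativeSemigroup)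
open import Data.Product using (∃-syntax; _×_; _,_; proj₁; proj₂)
open import Data.Sum using (_⊎_; inj₁; inj₂; [_,_]′)
open import Data.Unit using (⊤; tt)
open import Function using (_∘_; _⇔_; mk⇔; Equivalence)
import Function.Properties.Equivalence as ⇔
open import Relation.Nullary using (¬_; Dec; yes; no)
open import Relation.Binary.PropositionalEquality using (refl; sym; trans; cong; cong₂; subst; _≢_; module ≡-Reasoning)

open Equivalence using (to; from)
open ≡-Reasoning

σ321 : List ℕ
σ321 = 3 ∷ 2 ∷ 1 ∷ []

T-not : ∀ {x} → T (not x) ⇔ (¬ T x)
T-not {true}  = mk⇔ (λ ()) (λ ¬t → ¬t tt)
T-not {false} = mk⇔ (λ _ ()) (λ _ → tt)

≡false : ∀ {x} → ¬ T x → x ≡ false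
≡false {true}  ¬t = ⊥-elim (¬t tt)
≡false {false} _  = refl

<ᵇ-true : ∀ {m n} → m < n → (m <ᵇ n) ≡ true
<ᵇ-true = to T-≡ ∘ <⇒<ᵇ

<ᵇ-false : ∀ {m n} → n ≤ m → (m <ᵇ n) ≡ false
<ᵇ-false n≤m = ≡false (λ t → <⇒≱ (<ᵇ⇒< _ _ t) n≤m)

≡ᵇ-refl : ∀ m → (m ≡ᵇ m) ≡ true
≡ᵇ-refl m = to T-≡ (≡⇒≡ᵇ m m refl)

≡ᵇ-false : ∀ {m n} → m ≢ n → (m ≡ᵇ n) ≡ false
≡ᵇ-false m≢n = ≡false (m≢n ∘ ≡ᵇ⇒≡ _ _)

elemᵇ⇔∈ : ∀ {v} xs → T (elemᵇ v xs) ⇔ v ∈ xs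
elemᵇ⇔∈ {v} xs = mk⇔
  (Any.map (λ t → sym (≡ᵇ⇒≡ _ v t)) ∘ any⁻ _ xs)
  (any⁺ _ ∘ Any.map (λ { refl → ≡⇒≡ᵇ v v refl }))

-- Occurrences of 321

∈-subseqs⁻ : ∀ k xs {ys} → ys ∈ subseqs k xs → ys ⊆ xs
∈-subseqs⁻ zero    xs       (here refl) = minimum xs
∈-subseqs⁻ (suc k) (a ∷ as) ys∈ with ∈-++⁻ (map (a ∷_) (subseqs k as)) ys∈
... | inj₁ ys∈map with ∈-map⁻ (a ∷_) ys∈map
...   | _ , zs∈ , refl = refl ∷ ∈-subseqs⁻ k as zs∈
∈-subseqs⁻ (suc k) (a ∷ as) ys∈ | inj₂ ys∈rest = a Sublist.∷ʳ ∈-subseqs⁻ (suc k) as ys∈rest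

∈-subseqs⁺ : ∀ {xs ys} → ys ⊆ xs → ys ∈ subseqs (length ys) xs
∈-subseqs⁺ {ys = []}    _          = here refl
∈-subseqs⁺ {ys = _ ∷ _} (_ Sublist.∷ʳ sub) = ∈-++⁺ʳ _ (∈-subseqs⁺ sub)
∈-subseqs⁺ {ys = _ ∷ _} (refl ∷ sub) = ∈-++⁺ˡ (∈-map⁺ _ (∈-subseqs⁺ sub))

orderIso-321⁺ : ∀ {a b c} → b < a → c < b → T (orderIso (a ∷ b ∷ c ∷ []) σ321)
orderIso-321⁺ {a} {b} {c} b<a c<b
  rewrite <ᵇ-false (≤-refl {a}) | <ᵇ-false (≤-refl {b}) | <ᵇ-false (≤-refl {c})
        | <ᵇ-true b<a | <ᵇ-true c<b | <ᵇ-true (<-trans c<b b<a)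
        | <ᵇ-false (<⇒≤ b<a) | <ᵇ-false (<⇒≤ c<b) | <ᵇ-false (<⇒≤ (<-trans c<b b<a))
        | ≡ᵇ-refl a | ≡ᵇ-refl b | ≡ᵇ-refl c
        | ≡ᵇ-false (>⇒≢ b<a) | ≡ᵇ-false (<⇒≢ b<a) | ≡ᵇ-false (>⇒≢ c<b) | ≡ᵇ-false (<⇒≢ c<b)
        | ≡ᵇ-false (>⇒≢ (<-trans c<b b<a)) | ≡ᵇ-false (<⇒≢ (<-trans c<b b<a))
  = tt

agree : List ℕ → List ℕ → ℕ → ℕ → Bool
agree y σ s t =
  ((at y s <ᵇ at y t) ⇔ᵇ (at σ s <ᵇ at σ t)) ∧ ((at y s ≡ᵇ at y t) ⇔ᵇ (at σ s ≡ᵇ at σ t))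

orderIso⇒agree : ∀ y σ {s t} → s ∈ range1 (length σ) → t ∈ range1 (length σ) →
                 T (orderIso y σ) → T (agree y σ s t)
orderIso⇒agree y σ {s} s∈ t∈ iso =
  All.lookup (All.all⁺ (agree y σ s) _ (All.lookup rows s∈)) t∈
  where
  rows : All (λ s → T (all (agree y σ s) (range1 (length σ)))) (range1 (length σ))
  rows = All.all⁺ _ _ (proj₂ (to (T-∧ {length y ≡ᵇ length σ}) iso))

-- Entries (2,1) and (3,2) of the comparison table say b < a and c < b.
orderIso-321⁻ : ∀ {a b c} → T (orderIso (a ∷ b ∷ c ∷ []) σ321) → b < a × c < b
orderIso-321⁻ {a} {b} {c} iso =
  below (orderIso⇒agree (a ∷ b ∷ c ∷ []) σ321 (there (here refl)) (here refl) iso) ,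
  below (orderIso⇒agree (a ∷ b ∷ c ∷ []) σ321 (there (there (here refl))) (there (here refl)) iso)
  where
  ⇔ᵇtrue : ∀ {x} → T (x ⇔ᵇ true) → T x
  ⇔ᵇtrue {true} t = t

  below : ∀ {x y e} → T (((x <ᵇ y) ⇔ᵇ true) ∧ e) → x < y
  below {x} {y} entry = <ᵇ⇒< x y (⇔ᵇtrue (proj₁ (to T-∧ entry)))

data Has321 (x : List ℕ) : Set where
  occurs : ∀ {a b c} → (a ∷ b ∷ c ∷ []) ⊆ x → b < a → c < b → Has321 x

contains321⇔Has321 : ∀ x → T (containsᵇ x σ321) ⇔ Has321 x
contains321⇔Has321 x = mk⇔ occurrence (any⁺ _ ∘ witness)
  where
  occurrence : T (containsᵇ x σ321) → Has321 x
  occurrence t with find (any⁻ _ (subseqs 3 x) t)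
  ... | a ∷ b ∷ c ∷ [] , y∈ , iso = let b<a , c<b = orderIso-321⁻ iso in occurs (∈-subseqs⁻ 3 x y∈) b<a c<b
  ... | [] , _ , ()
  ... | _ ∷ [] , _ , ()
  ... | _ ∷ _ ∷ [] , _ , ()
  ... | _ ∷ _ ∷ _ ∷ _ ∷ _ , _ , ()

  witness : Has321 x → Any.Any (λ y → T (orderIso y σ321)) (subseqs 3 x)
  witness (occurs sub b<a c<b) = lose (∈-subseqs⁺ sub) (orderIso-321⁺ b<a c<b)

No21Below : ℕ → List ℕ → Set
No21Below a []      = ⊤
No21Below a (b ∷ r) = (b < a → All (b ≤_) r) × No21Below a r

No21Below⇒¬21 : ∀ {m r b c} → No21Below m r → (b ∷ c ∷ []) ⊆ r → b < m → c < b → ⊥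
No21Below⇒¬21 (_ , no21)     (_ Sublist.∷ʳ sub)   = No21Below⇒¬21 no21 sub
No21Below⇒¬21 (b-least , _) (refl ∷ sub) b<m c<b = <⇒≱ c<b (All.lookup (b-least b<m) (lookup sub (here refl)))

¬21⇒No21Below : ∀ {m} r → (∀ {b c} → (b ∷ c ∷ []) ⊆ r → b < m → c < b → ⊥) → No21Below m r
¬21⇒No21Below []      _   = tt
¬21⇒No21Below (b ∷ r) ¬21 =
  (λ b<m → All.tabulate (λ c∈r → ≮⇒≥ (¬21 (refl ∷ from∈ c∈r) b<m)))
  , ¬21⇒No21Below r (λ sub → ¬21 (b Sublist.∷ʳ sub))

avoids321⇔No21Below : ∀ {m r} → All (_≤ m) r → T (avoidsᵇ (m ∷ r) σ321) ⇔ No21Below m r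
avoids321⇔No21Below {m} {r} ≤m = mk⇔
  (λ t → ¬21⇒No21Below r (λ sub b<m c<b →
     to T-not t (from (contains321⇔Has321 _) (occurs (refl ∷ sub) b<m c<b))))
  (λ no21 → from T-not (λ t → ¬Has321 no21 (to (contains321⇔Has321 _) t)))
  where
  ¬Has321 : No21Below m r → ¬ Has321 (m ∷ r)
  ¬Has321 no21 (occurs {a} sub b<a c<b) with lookup {P = a ≡_} sub (here refl)
  ... | here refl  = No21Below⇒¬21 no21 (∷⁻ sub) b<a c<b
  ... | there a∈r = No21Below⇒¬21 no21 (∷⁻ sub) (<-≤-trans b<a (All.lookup ≤m a∈r)) c<b

-- Cayley permutations

Covers : ℕ → ℕ → List ℕ → Set
Covers v m r = ∀ {u} → v ≤ u → u < m → u ∈ r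

∈-range1⁻ : ∀ {v n} → v ∈ range1 n → 1 ≤ v × v ≤ n
∈-range1⁻ v∈ with ∈-map⁻ suc v∈
... | _ , w∈ , refl = s≤s z≤n , ∈-upTo⁻ w∈

∈-range1⁺ : ∀ {v n} → 1 ≤ v → v ≤ n → v ∈ range1 n
∈-range1⁺ {suc w} _ v≤n = ∈-map⁺ suc (∈-upTo⁺ v≤n)

maxL-bounded : ∀ {M} xs → All (_≤ M) xs → maxL xs ≤ M
maxL-bounded []       []         = z≤n
maxL-bounded (_ ∷ xs) (x≤M ∷ ≤M) = ⊔-lub x≤M (maxL-bounded xs ≤M)

isCayley⇔Covers : ∀ {m r} → All (_≤ m) r → T (isCayley (m ∷ r)) ⇔ Covers 1 m r
isCayley⇔Covers {m} {r} ≤m rewrite m≥n⇒m⊔n≡m (maxL-bounded r ≤m) = mk⇔ covers cayley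
  where
  covers : T (all (λ v → elemᵇ v (m ∷ r)) (range1 m)) → Covers 1 m r
  covers t 1≤u u<m with to (elemᵇ⇔∈ (m ∷ r)) (All.lookup (All.all⁺ _ _ t) (∈-range1⁺ 1≤u (<⇒≤ u<m)))
  ... | here u≡m  = ⊥-elim (<⇒≢ u<m u≡m)
  ... | there u∈r = u∈r

  cayley : Covers 1 m r → T (all (λ v → elemᵇ v (m ∷ r)) (range1 m))
  cayley cov = All.all⁻ _ (All.tabulate (λ v∈ → from (elemᵇ⇔∈ (m ∷ r)) (member (∈-range1⁻ v∈))))
    where
    member : ∀ {v} → 1 ≤ v × v ≤ m → v ∈ m ∷ r
    member (1≤v , v≤m) with m≤n⇒m<n∨m≡n v≤m
    ... | inj₁ v<m  = there (cov 1≤v v<m)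
    ... | inj₂ refl = here refl

-- Ascbot = Nub

Ascends : ℕ → List ℕ → Set
Ascends b []      = ⊥
Ascends b (c ∷ _) = b < c

-- Ascbot = Nub at every position of the word s ++ r that lies in r.
data NubAscbot (s : List ℕ) : List ℕ → Set where
  []  : NubAscbot s []
  new : ∀ {b r} → b ∉ s → Ascends b r → NubAscbot (s ∷ʳ b) r → NubAscbot s (b ∷ r)
  old : ∀ {b r} → b ∈ s → ¬ Ascends b r → NubAscbot (s ∷ʳ b) r → NubAscbot s (b ∷ r)

module _ {s : List ℕ} {b : ℕ} {r : List ℕ} where

  nubAscbot-tail : NubAscbot s (b ∷ r) → NubAscbot (s ∷ʳ b) r
  nubAscbot-tail (new _ _ nub) = nub
  nubAscbot-tail (old _ _ nub) = nub

  nubAscbot-new : NubAscbot s (b ∷ r) → b ∉ s → Ascends b r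
  nubAscbot-new (new _ asc _)  _   = asc
  nubAscbot-new (old b∈s _ _) b∉s = ⊥-elim (b∉s b∈s)

  nubAscbot-old : NubAscbot s (b ∷ r) → b ∈ s → ¬ Ascends b r
  nubAscbot-old (new b∉s _ _) b∈s = ⊥-elim (b∉s b∈s)
  nubAscbot-old (old _ flat _) _   = flat

ascendsᵇ : ℕ → List ℕ → Bool
ascendsᵇ b r = (0 <ᵇ length r) ∧ (b <ᵇ at r 1)

ascendsᵇ⇔Ascends : ∀ b r → T (ascendsᵇ b r) ⇔ Ascends b r
ascendsᵇ⇔Ascends b []      = mk⇔ (λ ()) (λ ())
ascendsᵇ⇔Ascends b (c ∷ _) = mk⇔ (<ᵇ⇒< b c) <⇒<ᵇ

-- The test of ascbotEqNub at the j-th letter of r, in a word s ++ r with s nonempty.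
ascbotIffNubAt : List ℕ → List ℕ → ℕ → Bool
ascbotIffNubAt s r j =
  ((j <ᵇ length r) ∧ (at r j <ᵇ at r (suc j))) ⇔ᵇ not (elemᵇ (at r j) (s ++ take (j ∸ 1) r))

all-range1 : ∀ (p : ℕ → Bool) k → all p (range1 k) ≡ all (p ∘ suc) (upTo k)
all-range1 p k = cong and (sym (map-∘ (upTo k)))

all-range1-suc : ∀ (p : ℕ → Bool) k → all p (range1 (suc k)) ≡ p 1 ∧ all (λ i → p (suc (suc i))) (upTo k)
all-range1-suc p k = cong (λ xs → p 1 ∧ and xs) (begin
  map p (map suc (applyUpTo suc k))  ≡⟨ cong (map p) (map-applyUpTo suc suc k) ⟩
  map p (applyUpTo (suc ∘ suc) k)    ≡⟨ map-applyUpTo (suc ∘ suc) p k ⟩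
  applyUpTo (p ∘ suc ∘ suc) k        ≡⟨ sym (map-upTo (p ∘ suc ∘ suc) k) ⟩
  map (p ∘ suc ∘ suc) (upTo k)       ∎)

ascbotEqNub-∷ : ∀ m r → ascbotEqNub (m ∷ r) ≡ all (ascbotIffNubAt [ m ] r) (range1 (length r))
ascbotEqNub-∷ m r = trans (all-range1-suc (λ i → inAscbot (m ∷ r) i ⇔ᵇ inNub (m ∷ r) i) (length r))
                           (sym (all-range1 (ascbotIffNubAt [ m ] r) (length r)))

all-ascbotIffNubAt-∷ : ∀ s b r →
  all (ascbotIffNubAt s (b ∷ r)) (range1 (suc (length r)))
    ≡ (ascendsᵇ b r ⇔ᵇ not (elemᵇ b s)) ∧ all (ascbotIffNubAt (s ∷ʳ b) r) (range1 (length r))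
all-ascbotIffNubAt-∷ s b r = begin
  all (ascbotIffNubAt s (b ∷ r)) (range1 (suc (length r)))
    ≡⟨ all-range1-suc _ (length r) ⟩
  ascbotIffNubAt s (b ∷ r) 1 ∧ all (λ i → ascbotIffNubAt s (b ∷ r) (suc (suc i))) (upTo (length r))
    ≡⟨ cong₂ _∧_ (cong (λ t → ascendsᵇ b r ⇔ᵇ not (elemᵇ b t)) (++-identityʳ s))
                 (cong and (map-cong shift (upTo (length r)))) ⟩
  (ascendsᵇ b r ⇔ᵇ not (elemᵇ b s)) ∧ all (ascbotIffNubAt (s ∷ʳ b) r ∘ suc) (upTo (length r))
    ≡⟨ cong ((ascendsᵇ b r ⇔ᵇ not (elemᵇ b s)) ∧_) (sym (all-range1 _ (length r))) ⟩
  (ascendsᵇ b r ⇔ᵇ not (elemᵇ b s)) ∧ all (ascbotIffNubAt (s ∷ʳ b) r) (range1 (length r)) ∎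
  where
  shift : ∀ i → ascbotIffNubAt s (b ∷ r) (suc (suc i)) ≡ ascbotIffNubAt (s ∷ʳ b) r (suc i)
  shift i = cong (λ t → ((suc i <ᵇ length r) ∧ (at r (suc i) <ᵇ at r (suc (suc i))))
                          ⇔ᵇ not (elemᵇ (at r (suc i)) t))
                 (sym (++-assoc s [ b ] (take i r)))

⇔ᵇ-not⁻ : ∀ a e → T (a ⇔ᵇ not e) → (T e → ¬ T a) × (¬ T e → T a)
⇔ᵇ-not⁻ true  false _ = (λ ()) , _
⇔ᵇ-not⁻ false true  _ = (λ _ ()) , (λ ¬t → ⊥-elim (¬t tt))

⇔ᵇ-not⁺ : ∀ a e → (T e → ¬ T a) → (¬ T e → T a) → T (a ⇔ᵇ not e)
⇔ᵇ-not⁺ true  true  flat _   = flat tt tt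
⇔ᵇ-not⁺ true  false _    _   = tt
⇔ᵇ-not⁺ false true  _    _   = tt
⇔ᵇ-not⁺ false false _    asc = asc (λ ())

all-ascbotIffNubAt⇔NubAscbot : ∀ s r → T (all (ascbotIffNubAt s r) (range1 (length r))) ⇔ NubAscbot s r
all-ascbotIffNubAt⇔NubAscbot s []      = mk⇔ (λ _ → []) (λ _ → tt)
all-ascbotIffNubAt⇔NubAscbot s (b ∷ r) rewrite all-ascbotIffNubAt-∷ s b r = mk⇔ scan unscan
  where
  rest⇔ : T (all (ascbotIffNubAt (s ∷ʳ b) r) (range1 (length r))) ⇔ NubAscbot (s ∷ʳ b) r
  rest⇔ = all-ascbotIffNubAt⇔NubAscbot (s ∷ʳ b) r

  scan : T ((ascendsᵇ b r ⇔ᵇ not (elemᵇ b s)) ∧ all (ascbotIffNubAt (s ∷ʳ b) r) (range1 (length r))) →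
         NubAscbot s (b ∷ r)
  scan t with to T-∧ t | b ∈? s
  ... | head , rest | yes b∈s =
    old b∈s (proj₁ (⇔ᵇ-not⁻ _ _ head) (from (elemᵇ⇔∈ s) b∈s) ∘ from (ascendsᵇ⇔Ascends b r))
        (to rest⇔ rest)
  ... | head , rest | no b∉s =
    new b∉s (to (ascendsᵇ⇔Ascends b r) (proj₂ (⇔ᵇ-not⁻ _ _ head) (b∉s ∘ to (elemᵇ⇔∈ s))))
        (to rest⇔ rest)

  unscan : NubAscbot s (b ∷ r) →
           T ((ascendsᵇ b r ⇔ᵇ not (elemᵇ b s)) ∧ all (ascbotIffNubAt (s ∷ʳ b) r) (range1 (length r)))
  unscan nub = from T-∧
    ( ⇔ᵇ-not⁺ _ _ (λ e a → nubAscbot-old nub (to (elemᵇ⇔∈ s) e) (to (ascendsᵇ⇔Ascends b r) a))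
                  (λ ¬e → from (ascendsᵇ⇔Ascends b r) (nubAscbot-new nub (¬e ∘ from (elemᵇ⇔∈ s))))
    , from rest⇔ (nubAscbot-tail nub))

ascbotEqNub⇔NubAscbot : ∀ m r → T (ascbotEqNub (m ∷ r)) ⇔ NubAscbot [ m ] r
ascbotEqNub⇔NubAscbot m r rewrite ascbotEqNub-∷ m r = all-ascbotIffNubAt⇔NubAscbot [ m ] r

¬Ascends-bounded : ∀ {b r} → All (_≤ b) r → ¬ Ascends b r
¬Ascends-bounded {r = []}    _         ()
¬Ascends-bounded {r = _ ∷ _} (c≤b ∷ _) b<c = <⇒≱ b<c c≤b

above⇒∉ : ∀ {b : ℕ} {s} → All (_< b) s → b ∉ s
above⇒∉ <b b∈s = <-irrefl refl (All.lookup <b b∈s)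

-- A letter above everything read so far is new, so it must ascend to a yet larger new letter, and
-- so on: such a chain of records cannot end.
nubAscbot-¬record : ∀ {s b r} → NubAscbot s (b ∷ r) → All (_< b) s → ⊥
nubAscbot-¬record {r = []}    nub <b = nubAscbot-new nub (above⇒∉ <b)
nubAscbot-¬record {r = c ∷ r} nub <b with nubAscbot-new nub (above⇒∉ <b)
... | b<c = nubAscbot-¬record (nubAscbot-tail nub) (All.++⁺ (All.map (λ x<b → <-trans x<b b<c) <b) (b<c ∷ []))

nubAscbot-bounded : ∀ {M s r} → All (_≤ M) s → NubAscbot s r → All (_≤ M) r
nubAscbot-bounded {r = []}    _  _   = []
nubAscbot-bounded {M} {r = b ∷ r} ≤M nub with b ≤? M
... | yes b≤M = b≤M ∷ nubAscbot-bounded (All.++⁺ ≤M (b≤M ∷ [])) (nubAscbot-tail nub)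
... | no b≰M  = ⊥-elim (nubAscbot-¬record nub (All.map (λ x≤M → ≤-<-trans x≤M (≰⇒> b≰M)) ≤M))

nubAscbot-≤head : ∀ {m r} → NubAscbot [ m ] r → All (_≤ m) r
nubAscbot-≤head = nubAscbot-bounded (≤-refl ∷ [])

nubAscbot-constant : ∀ {s b r} → NubAscbot s (b ∷ r) → b ∈ s → All (b ≤_) r → All (_≡ b) r
nubAscbot-constant {r = []}    _   _   _           = []
nubAscbot-constant {s} {b} {c ∷ r} nub b∈s (b≤c ∷ b≤r) =
  c≡b ∷ nubAscbot-constant (subst (λ z → NubAscbot (s ∷ʳ b) (z ∷ r)) c≡b (nubAscbot-tail nub))
                           (∈-++⁺ˡ b∈s) b≤r
  where
  c≡b : c ≡ b
  c≡b = ≤-antisym (≮⇒≥ (nubAscbot-old nub b∈s)) b≤c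

nubAscbot-repeat : ∀ {s b r} → b ∈ s → All (_≡ b) r → NubAscbot s r
nubAscbot-repeat _   []           = []
nubAscbot-repeat b∈s (refl ∷ ≡b) =
  old b∈s (¬Ascends-bounded (All.map ≤-reflexive ≡b)) (nubAscbot-repeat (∈-++⁺ˡ b∈s) ≡b)

No21Below-constant : ∀ {m b r} → All (_≡ b) r → No21Below m r
No21Below-constant []           = tt
No21Below-constant (refl ∷ ≡b) =
  (λ _ → All.map (λ x≡b → ≤-reflexive (sym x≡b)) ≡b) , No21Below-constant ≡b

∈-tail : ∀ {u b : ℕ} {r} → u ≢ b → u ∈ b ∷ r → u ∈ r
∈-tail u≢b (here u≡b) = ⊥-elim (u≢b u≡b)
∈-tail _   (there u∈r) = u∈r

record Seen (m v : ℕ) (s : List ℕ) : Set where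
  field
    top∈     : m ∈ s
    below∈   : ∀ {x} → 1 ≤ x → x < v → x ∈ s
    pending∉ : ∀ {x} → v ≤ x → x < m → x ∉ s
open Seen

seen-init : ∀ {m} → Seen m 1 [ m ]
seen-init = record
  { top∈     = here refl
  ; below∈   = λ 1≤x x<1 → ⊥-elim (<⇒≱ x<1 1≤x)
  ; pending∉ = λ { _ x<m (here x≡m) → <⇒≢ x<m x≡m } }

seen-top : ∀ {m v s} → Seen m v s → Seen m v (s ∷ʳ m)
seen-top {m} {v} {s} seen = record
  { top∈     = ∈-++⁺ˡ (top∈ seen)
  ; below∈   = λ 1≤x x<v → ∈-++⁺ˡ (below∈ seen 1≤x x<v)
  ; pending∉ = λ v≤x x<m x∈ → pending (∈-++⁻ s x∈) v≤x x<m }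
  where
  pending : ∀ {x} → x ∈ s ⊎ x ∈ [ m ] → v ≤ x → x < m → ⊥
  pending (inj₁ x∈s)         v≤x x<m = pending∉ seen v≤x x<m x∈s
  pending (inj₂ (here refl)) _   m<m = <-irrefl refl m<m

seen-next : ∀ {m v s} → Seen m v s → Seen m (suc v) (s ∷ʳ v)
seen-next {m} {v} {s} seen = record
  { top∈     = ∈-++⁺ˡ (top∈ seen)
  ; below∈   = below
  ; pending∉ = λ v<x x<m x∈ → pending (∈-++⁻ s x∈) v<x x<m }
  where
  below : ∀ {x} → 1 ≤ x → x < suc v → x ∈ s ∷ʳ v
  below 1≤x x<sv with m≤n⇒m<n∨m≡n (≤-pred x<sv)
  ... | inj₁ x<v  = ∈-++⁺ˡ (below∈ seen 1≤x x<v)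
  ... | inj₂ refl = ∈-++⁺ʳ s (here refl)

  pending : ∀ {x} → x ∈ s ⊎ x ∈ [ v ] → suc v ≤ x → x < m → ⊥
  pending (inj₁ x∈s)         v<x x<m = pending∉ seen (<⇒≤ v<x) x<m x∈s
  pending (inj₂ (here refl)) v<v _   = <-irrefl refl v<v

-- The automaton

-- `expecting v` awaits the new letter v; after m − 1 comes the forced m (`topNext`), then m* (m−1)*.
data State : Set where
  expecting : ℕ → State
  topNext topsThenTail tail onlyTops dead : State

afterNew : ℕ → ℕ → State
afterNew m v with suc v ≟ m
... | yes _ = topNext
... | no _  = expecting (suc v)

step : ℕ → State → ℕ → State
step m (expecting v) b with b ≟ m | b ≟ v
... | yes _ | _     = expecting v
... | no _  | yes _ = afterNew m v
... | no _  | no _  = dead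
step m topNext b with b ≟ m
... | yes _ = topsThenTail
... | no _  = dead
step m topsThenTail b with b ≟ m | b ≟ pred m
... | yes _ | _     = topsThenTail
... | no _  | yes _ = tail
... | no _  | no _  = dead
step m tail b with b ≟ pred m
... | yes _ = tail
... | no _  = dead
step m onlyTops b with b ≟ m
... | yes _ = onlyTops
... | no _  = dead
step m dead b = dead

accepting : State → Bool
accepting topsThenTail = true
accepting tail         = true
accepting onlyTops     = true
accepting _            = false

run : ℕ → State → List ℕ → Bool
run m q []      = accepting q
run m q (b ∷ r) = run m (step m q b) r

start : ℕ → State
start (suc zero) = onlyTops
start _          = expecting 1

dead-rejects : ∀ m r → ¬ T (run m dead r)
dead-rejects m []      ()
dead-rejects m (b ∷ r) = dead-rejects m r

onlyTops-accepts : ∀ {m r} → All (_≡ m) r → T (run m onlyTops r)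
onlyTops-accepts [] = tt
onlyTops-accepts {m} (_∷_ {b} b≡m ≡m) with b ≟ m
... | yes _   = onlyTops-accepts ≡m
... | no b≢m = ⊥-elim (b≢m b≡m)

tail-accepts : ∀ {p r} → All (_≡ p) r → T (run (suc p) tail r)
tail-accepts [] = tt
tail-accepts {p} (_∷_ {b} b≡p ≡p) with b ≟ p
... | yes _   = tail-accepts ≡p
... | no b≢p = ⊥-elim (b≢p b≡p)

topsThenTail-accepts : ∀ {p s r} → p ∈ s → NubAscbot s r → All (_≤ suc p) r → All (p ≤_) r →
                       T (run (suc p) topsThenTail r)
topsThenTail-accepts {r = []} _ _ _ _ = tt
topsThenTail-accepts {p} {r = b ∷ r} p∈s nub (b≤m ∷ ≤m) (p≤b ∷ p≤) with b ≟ suc p | b ≟ p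
... | yes _    | _       = topsThenTail-accepts (∈-++⁺ˡ p∈s) (nubAscbot-tail nub) ≤m p≤
... | no _     | yes refl = tail-accepts (nubAscbot-constant nub p∈s p≤)
... | no b≢m | no b≢p  = ⊥-elim (b≢p (≤-antisym (≤-pred (≤∧≢⇒< b≤m b≢m)) p≤b))

topNext-accepts : ∀ {p s r} → p ∉ s → NubAscbot s (p ∷ r) → All (_≤ suc p) r → All (p ≤_) r →
                  T (run (suc p) topNext r)
topNext-accepts {r = []} p∉s nub _ _ = nubAscbot-new nub p∉s
topNext-accepts {p} {s} {c ∷ r} p∉s nub (c≤m ∷ ≤m) (_ ∷ p≤) with c ≟ suc p
... | yes refl =
  topsThenTail-accepts (∈-++⁺ˡ (∈-++⁺ʳ s (here refl))) (nubAscbot-tail (nubAscbot-tail nub)) ≤m p≤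
... | no c≢m  = ⊥-elim (c≢m (≤-antisym c≤m (nubAscbot-new nub p∉s)))

-- The awaited letter v occurs later, yet an earlier old letter b < v forces everything after it to equal b.
¬skip : ∀ {m v s b r} → Seen m v s → v < m → NubAscbot s (b ∷ r) → 1 ≤ b → b ≢ v → All (b ≤_) r →
        Covers v m (b ∷ r) → ⊥
¬skip {v = v} {b = b} {r = r} seen v<m nub 1≤b b≢v b≤ covers = b≢v (sym (All.lookup ≡b v∈r))
  where
  v∈r : v ∈ r
  v∈r = ∈-tail (b≢v ∘ sym) (covers ≤-refl v<m)

  ≡b : All (_≡ b) r
  ≡b = nubAscbot-constant nub (below∈ seen 1≤b (≤∧≢⇒< (All.lookup b≤ v∈r) b≢v)) b≤

expecting-accepts : ∀ {m v s r} → Seen m v s → v < m → NubAscbot s r → All (1 ≤_) r → All (_≤ m) r →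
                    No21Below m r → Covers v m r → T (run m (expecting v) r)
afterNew-accepts : ∀ {m v s r} → Seen m v s → v < m → NubAscbot s (v ∷ r) → All (1 ≤_) r → All (_≤ m) r →
                   No21Below m (v ∷ r) → Covers v m (v ∷ r) → T (run m (afterNew m v) r)

expecting-accepts {r = []} _ v<m _ _ _ _ covers with () ← covers ≤-refl v<m
expecting-accepts {m} {v} {r = b ∷ r} seen v<m nub (1≤b ∷ pos) (b≤m ∷ ≤m) (b-least , no21) covers
  with b ≟ m | b ≟ v
... | yes refl | _ = expecting-accepts (seen-top seen) v<m (nubAscbot-tail nub) pos ≤m no21
                       (λ v≤u u<m → ∈-tail (<⇒≢ u<m) (covers v≤u u<m))
... | no _    | yes refl = afterNew-accepts seen v<m nub pos ≤m (b-least , no21) covers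
... | no b≢m | no b≢v  = ⊥-elim (¬skip seen v<m nub 1≤b b≢v (b-least (≤∧≢⇒< b≤m b≢m)) covers)

afterNew-accepts {m} {v} seen v<m nub pos ≤m (v-least , no21) covers with suc v ≟ m
... | yes refl = topNext-accepts (pending∉ seen ≤-refl v<m) nub ≤m (v-least v<m)
... | no sv≢m = expecting-accepts (seen-next seen) (≤∧≢⇒< v<m sv≢m) (nubAscbot-tail nub) pos ≤m no21
                  (λ v<u u<m → ∈-tail (>⇒≢ v<u) (covers (<⇒≤ v<u) u<m))

onlyTops-accepted : ∀ {m} r → T (run m onlyTops r) → All (_≡ m) r
onlyTops-accepted []          _ = []
onlyTops-accepted {m} (b ∷ r) t with b ≟ m
... | yes b≡m = b≡m ∷ onlyTops-accepted r t
... | no _    = ⊥-elim (dead-rejects m r t)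

tail-accepted : ∀ {p} r → T (run (suc p) tail r) → All (_≡ p) r
tail-accepted []          _ = []
tail-accepted {p} (b ∷ r) t with b ≟ p
... | yes b≡p = b≡p ∷ tail-accepted r t
... | no _    = ⊥-elim (dead-rejects (suc p) r t)

topNext-accepted : ∀ {m} r → T (run m topNext r) → ∃[ r′ ] r ≡ m ∷ r′ × T (run m topsThenTail r′)
topNext-accepted {m} (b ∷ r) t with b ≟ m
... | yes refl = r , refl , t
... | no _     = ⊥-elim (dead-rejects m r t)

record Suffix (m v : ℕ) (s r : List ℕ) : Set where
  field
    nubAscbot : NubAscbot s r
    bounded   : All (_≤ m) r
    above     : All (v ≤_) r
    no21      : No21Below m r
open Suffix

suffix-top : ∀ {m v s r} → m ∈ s → v ≤ m → Suffix m v (s ∷ʳ m) r → Suffix m v s (m ∷ r)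
suffix-top m∈s v≤m rest = record
  { nubAscbot = old m∈s (¬Ascends-bounded (bounded rest)) (nubAscbot rest)
  ; bounded   = ≤-refl ∷ bounded rest
  ; above     = v≤m ∷ above rest
  ; no21      = (λ m<m → ⊥-elim (<-irrefl refl m<m)) , no21 rest }

suffix-new : ∀ {m v s r} → v ∉ s → Ascends v r → v ≤ m → Suffix m v (s ∷ʳ v) r → Suffix m v s (v ∷ r)
suffix-new v∉s asc v≤m rest = record
  { nubAscbot = new v∉s asc (nubAscbot rest)
  ; bounded   = v≤m ∷ bounded rest
  ; above     = ≤-refl ∷ above rest
  ; no21      = (λ _ → above rest) , no21 rest }

suffix-constant : ∀ {m p s r} → p ∈ s → p ≤ m → All (_≡ p) r → Suffix m p s r
suffix-constant p∈s p≤m ≡p = record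
  { nubAscbot = nubAscbot-repeat p∈s ≡p
  ; bounded   = All.map (λ { refl → p≤m }) ≡p
  ; above     = All.map (λ { refl → ≤-refl }) ≡p
  ; no21      = No21Below-constant ≡p }

suffix-lower : ∀ {m v w s r} → v ≤ w → Suffix m w s r → Suffix m v s r
suffix-lower v≤w rest = record
  { nubAscbot = nubAscbot rest
  ; bounded   = bounded rest
  ; above     = All.map (≤-trans v≤w) (above rest)
  ; no21      = no21 rest }

ascends-above : ∀ {v x r} → x ∈ r → All (suc v ≤_) r → Ascends v r
ascends-above (here _)  (v<c ∷ _) = v<c
ascends-above (there _) (v<c ∷ _) = v<c

topsThenTail-accepted : ∀ {p s} r → 1 ≤ p → Seen (suc p) (suc p) s → T (run (suc p) topsThenTail r) →
                        Suffix (suc p) p s r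
topsThenTail-accepted [] 1≤p seen _ = suffix-constant (below∈ seen 1≤p ≤-refl) (n≤1+n _) []
topsThenTail-accepted {p} (b ∷ r) 1≤p seen t with b ≟ suc p | b ≟ p
... | yes refl | _ = suffix-top (top∈ seen) (n≤1+n p) (topsThenTail-accepted r 1≤p (seen-top seen) t)
... | no _ | yes refl = suffix-constant (below∈ seen 1≤p ≤-refl) (n≤1+n p) (refl ∷ tail-accepted r t)
... | no _ | no _ = ⊥-elim (dead-rejects (suc p) r t)

expecting-accepted : ∀ {m v s} r → 1 ≤ v → v < m → Seen m v s → T (run m (expecting v) r) →
                     Suffix m v s r × Covers v m r
afterNew-accepted : ∀ {m v s} r → 1 ≤ v → v < m → Seen m v s → T (run m (afterNew m v) r) →
                    Suffix m v s (v ∷ r) × Covers v m (v ∷ r)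

expecting-accepted {m} {v} (b ∷ r) 1≤v v<m seen t with b ≟ m | b ≟ v
... | yes refl | _ =
  let rest , covers = expecting-accepted r 1≤v v<m (seen-top seen) t
  in suffix-top (top∈ seen) (<⇒≤ v<m) rest , (λ v≤u u<m → there (covers v≤u u<m))
... | no _ | yes refl = afterNew-accepted r 1≤v v<m seen t
... | no _ | no _ = ⊥-elim (dead-rejects m r t)

afterNew-accepted {m} {v} r 1≤v v<m seen t with suc v ≟ m
... | yes refl with topNext-accepted r t
...   | r′ , refl , t′ =
  suffix-new (pending∉ seen ≤-refl v<m) (n<1+n v) (n≤1+n v)
    (suffix-top (top∈ (seen-next seen)) (n≤1+n v) (topsThenTail-accepted r′ 1≤v (seen-top (seen-next seen)) t′))
  , λ v≤u u<sv → here (≤-antisym (≤-pred u<sv) v≤u)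
afterNew-accepted {m} {v} r 1≤v v<m seen t | no sv≢m =
  let sv<m = ≤∧≢⇒< v<m sv≢m
      rest , covers = expecting-accepted r (s≤s z≤n) sv<m (seen-next seen) t
  in suffix-new (pending∉ seen ≤-refl v<m) (ascends-above (covers ≤-refl sv<m) (above rest)) (<⇒≤ v<m)
       (suffix-lower (n≤1+n v) rest)
     , λ v≤u u<m → [ (λ v<u → there (covers v<u u<m)) , (λ { refl → here refl }) ]′ (m≤n⇒m<n∨m≡n v≤u)

Conditions : ℕ → List ℕ → Set
Conditions m r = NubAscbot [ m ] r × No21Below m r × Covers 1 m r

RAS321 : List ℕ → Bool
RAS321 x = isRevisedAscentSeq x ∧ avoidsᵇ x σ321

RAS321⇔Conditions : ∀ m r → T (RAS321 (m ∷ r)) ⇔ Conditions m r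
RAS321⇔Conditions m r = mk⇔ conditions ras
  where
  conditions : T (RAS321 (m ∷ r)) → Conditions m r
  conditions t =
    let cayley-ascbot , avoids = to T-∧ t
        cayley , ascbot = to T-∧ cayley-ascbot
        nub = to (ascbotEqNub⇔NubAscbot m r) ascbot
    in nub , to (avoids321⇔No21Below (nubAscbot-≤head nub)) avoids
           , to (isCayley⇔Covers (nubAscbot-≤head nub)) cayley

  ras : Conditions m r → T (RAS321 (m ∷ r))
  ras (nub , no21 , covers) = from T-∧
    ( from T-∧ (from (isCayley⇔Covers (nubAscbot-≤head nub)) covers , from (ascbotEqNub⇔NubAscbot m r) nub)
    , from (avoids321⇔No21Below (nubAscbot-≤head nub)) no21 )

accepts⇔Conditions : ∀ {m r} → 1 ≤ m → All (1 ≤_) r → T (run m (start m) r) ⇔ Conditions m r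
accepts⇔Conditions {suc zero} {r} _ pos = mk⇔ conditions accepts
  where
  conditions : T (run 1 onlyTops r) → Conditions 1 r
  conditions t = nubAscbot-repeat (here refl) ≡1 , No21Below-constant ≡1 , λ 1≤u u<1 → ⊥-elim (<⇒≱ u<1 1≤u)
    where
    ≡1 : All (_≡ 1) r
    ≡1 = onlyTops-accepted r t

  accepts : Conditions 1 r → T (run 1 onlyTops r)
  accepts (nub , _ , _) =
    onlyTops-accepts (All.zipWith (λ (x≤1 , 1≤x) → ≤-antisym x≤1 1≤x) (nubAscbot-≤head nub , pos))
accepts⇔Conditions {m@(suc (suc _))} {r} _ pos = mk⇔ conditions accepts
  where
  conditions : T (run m (expecting 1) r) → Conditions m r
  conditions t with expecting-accepted r ≤-refl (s≤s (s≤s z≤n)) seen-init t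
  ... | suffix , covers = nubAscbot suffix , no21 suffix , covers

  accepts : Conditions m r → T (run m (expecting 1) r)
  accepts (nub , no21 , covers) =
    expecting-accepts seen-init (s≤s (s≤s z≤n)) nub pos (nubAscbot-≤head nub) no21 covers

RAS321⇔accepts : ∀ {m r} → 1 ≤ m → All (1 ≤_) r → T (RAS321 (m ∷ r)) ⇔ T (run m (start m) r)
RAS321⇔accepts {m} {r} 1≤m pos = ⇔.trans (RAS321⇔Conditions m r) (⇔.sym (accepts⇔Conditions 1≤m pos))

-- Counting

sumBelow : ℕ → (ℕ → ℕ) → ℕ
sumBelow zero    f = 0
sumBelow (suc n) f = f 0 + sumBelow n (f ∘ suc)

sum-map-upTo : ∀ n f → sum (map f (upTo n)) ≡ sumBelow n f
sum-map-upTo zero    f = refl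
sum-map-upTo (suc n) f = cong (f 0 +_) (begin
  sum (map f (applyUpTo suc n))  ≡⟨ cong sum (map-applyUpTo suc f n) ⟩
  sum (applyUpTo (f ∘ suc) n)    ≡⟨ cong sum (sym (map-upTo (f ∘ suc) n)) ⟩
  sum (map (f ∘ suc) (upTo n))   ≡⟨ sum-map-upTo n (f ∘ suc) ⟩
  sumBelow n (f ∘ suc)           ∎)

sum-map-range1 : ∀ n f → sum (map f (range1 n)) ≡ sumBelow n (f ∘ suc)
sum-map-range1 n f = trans (cong sum (sym (map-∘ (upTo n)))) (sum-map-upTo n (f ∘ suc))

sumBelow-cong : ∀ n {f g} → (∀ j → j < n → f j ≡ g j) → sumBelow n f ≡ sumBelow n g
sumBelow-cong zero    _   = refl
sumBelow-cong (suc n) f≡g = cong₂ _+_ (f≡g 0 (s≤s z≤n)) (sumBelow-cong n (λ j j<n → f≡g (suc j) (s≤s j<n)))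

sumBelow-+ : ∀ n f g → sumBelow n (λ j → f j + g j) ≡ sumBelow n f + sumBelow n g
sumBelow-+ zero    f g = refl
sumBelow-+ (suc n) f g = trans (cong (f 0 + g 0 +_) (sumBelow-+ n (f ∘ suc) (g ∘ suc)))
                               (interchange +-commutativeSemigroup (f 0) (g 0) _ _)

sumBelow-snoc : ∀ n f → sumBelow (suc n) f ≡ sumBelow n f + f n
sumBelow-snoc zero    f = +-identityʳ (f 0)
sumBelow-snoc (suc n) f = trans (cong (f 0 +_) (sumBelow-snoc n (f ∘ suc))) (sym (+-assoc (f 0) _ _))

sumBelow-zero : ∀ n → sumBelow n (λ _ → 0) ≡ 0
sumBelow-zero zero    = refl
sumBelow-zero (suc n) = sumBelow-zero n

sumBelow-binomial : ∀ N L → N < L → sumBelow L (N C_) ≡ 2 ^ N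
sumBelow-binomial zero    (suc L) _ = cong suc (sumBelow-zero L)
sumBelow-binomial (suc N) (suc L) (s≤s N<L) = begin
  suc (sumBelow L (λ j → suc N C suc j))
    ≡⟨ cong suc (sumBelow-cong L (λ j _ → sym (nCk+nC[k+1]≡[n+1]C[k+1] N j))) ⟩
  suc (sumBelow L (λ j → N C j + N C suc j))
    ≡⟨ cong suc (sumBelow-+ L (N C_) (λ j → N C suc j)) ⟩
  suc (sumBelow L (N C_) + sumBelow L (λ j → N C suc j))
    ≡⟨ sym (+-suc (sumBelow L (N C_)) _) ⟩
  sumBelow L (N C_) + sumBelow (suc L) (N C_)
    ≡⟨ cong₂ _+_ (sumBelow-binomial N L N<L) (sumBelow-binomial N (suc L) (m≤n⇒m≤1+n N<L)) ⟩
  2 ^ N + 2 ^ N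
    ≡⟨ cong (2 ^ N +_) (sym (+-identityʳ (2 ^ N))) ⟩
  2 ^ suc N ∎

point : ℕ → ℕ → ℕ → ℕ
point p A b with b ≟ p
... | yes _ = A
... | no _  = 0

point-hit : ∀ p A → point p A p ≡ A
point-hit p A with p ≟ p
... | yes _   = refl
... | no p≢p = ⊥-elim (p≢p refl)

point-miss : ∀ {b p} A → b ≢ p → point p A b ≡ 0
point-miss {b} {p} A b≢p with b ≟ p
... | yes b≡p = ⊥-elim (b≢p b≡p)
... | no _    = refl

sumBelow-point-beyond : ∀ n {p A} → n < p → sumBelow n (λ j → point p A (suc j)) ≡ 0
sumBelow-point-beyond zero    _   = refl
sumBelow-point-beyond (suc n) {p} {A} n<p = begin
  sumBelow (suc n) (λ j → point p A (suc j))
    ≡⟨ sumBelow-snoc n (λ j → point p A (suc j)) ⟩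
  sumBelow n (λ j → point p A (suc j)) + point p A (suc n)
    ≡⟨ cong₂ _+_ (sumBelow-point-beyond n (<-trans (n<1+n n) n<p)) (point-miss A (<⇒≢ n<p)) ⟩
  0 ∎

sumBelow-point : ∀ n {p A} → 1 ≤ p → p ≤ n → sumBelow n (λ j → point p A (suc j)) ≡ A
sumBelow-point zero    (s≤s _) ()
sumBelow-point (suc n) {p} {A} 1≤p p≤sn =
  trans (sumBelow-snoc n (λ j → point p A (suc j))) (last (m≤n⇒m<n∨m≡n p≤sn))
  where
  last : p < suc n ⊎ p ≡ suc n → sumBelow n (λ j → point p A (suc j)) + point p A (suc n) ≡ A
  last (inj₁ p<sn) = begin
    sumBelow n (λ j → point p A (suc j)) + point p A (suc n)
      ≡⟨ cong₂ _+_ (sumBelow-point n 1≤p (≤-pred p<sn)) (point-miss A (>⇒≢ p<sn)) ⟩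
    A + 0
      ≡⟨ +-identityʳ A ⟩
    A ∎
  last (inj₂ refl) = cong₂ _+_ (sumBelow-point-beyond n ≤-refl) (point-hit (suc n) A)

length-filter-prepend : ∀ (p : List ℕ → Bool) a W →
  length (filter (λ x → T? (p x)) (map (a ∷_) W)) ≡ length (filter (λ x → T? (p (a ∷ x))) W)
length-filter-prepend p a []      = refl
length-filter-prepend p a (w ∷ W) with p (a ∷ w)
... | true  = cong suc (length-filter-prepend p a W)
... | false = length-filter-prepend p a W

length-filter-concatMap : ∀ (p : List ℕ → Bool) W L →
  length (filter (λ x → T? (p x)) (concatMap (λ a → map (a ∷_) W) L))
    ≡ sum (map (λ a → length (filter (λ x → T? (p (a ∷ x))) W)) L)
length-filter-concatMap p W []      = refl
length-filter-concatMap p W (a ∷ L) = begin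
  length (filter P? (map (a ∷_) W ++ concatMap (λ a → map (a ∷_) W) L))
    ≡⟨ cong length (filter-++ P? (map (a ∷_) W) _) ⟩
  length (filter P? (map (a ∷_) W) ++ filter P? (concatMap (λ a → map (a ∷_) W) L))
    ≡⟨ length-++ (filter P? (map (a ∷_) W)) ⟩
  length (filter P? (map (a ∷_) W)) + length (filter P? (concatMap (λ a → map (a ∷_) W) L))
    ≡⟨ cong₂ _+_ (length-filter-prepend p a W) (length-filter-concatMap p W L) ⟩
  sum (map (λ a → length (filter (λ x → T? (p (a ∷ x))) W)) (a ∷ L)) ∎
  where
  P? : (x : List ℕ) → Dec (T (p x))
  P? x = T? (p x)

length-filter-wordsOver : ∀ (p : List ℕ → Bool) n k →
  length (filter (λ x → T? (p x)) (wordsOver n (suc k)))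
    ≡ sumBelow n (λ j → length (filter (λ x → T? (p (suc j ∷ x))) (wordsOver n k)))
length-filter-wordsOver p n k =
  trans (length-filter-concatMap p (wordsOver n k) (range1 n)) (sum-map-range1 n _)

module Counting (n : ℕ) where

  runs : ℕ → State → ℕ → ℕ
  runs m q k = length (filter (λ r → T? (run m q r)) (wordsOver n k))

  runs-dead : ∀ m k → runs m dead k ≡ 0
  runs-dead m k =
    cong length (filter-none (λ r → T? (run m dead r)) {xs = wordsOver n k} (All.tabulate (λ {r} _ → dead-rejects m r)))

  runs-step₁ : ∀ {m q} k {p A} → 1 ≤ p → p ≤ n → (∀ b → runs m (step m q b) k ≡ point p A b) →
               runs m q (suc k) ≡ A
  runs-step₁ {m} {q} k 1≤p p≤n next =
    trans (length-filter-wordsOver (run m q) n k)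
          (trans (sumBelow-cong n (λ j _ → next (suc j))) (sumBelow-point n 1≤p p≤n))

  runs-step₂ : ∀ {m q} k {p A p′ B} → 1 ≤ p → p ≤ n → 1 ≤ p′ → p′ ≤ n →
               (∀ b → runs m (step m q b) k ≡ point p A b + point p′ B b) → runs m q (suc k) ≡ A + B
  runs-step₂ {m} {q} k {p} {A} {p′} {B} 1≤p p≤n 1≤p′ p′≤n next = begin
    runs m q (suc k)
      ≡⟨ length-filter-wordsOver (run m q) n k ⟩
    sumBelow n (λ j → runs m (step m q (suc j)) k)
      ≡⟨ sumBelow-cong n (λ j _ → next (suc j)) ⟩
    sumBelow n (λ j → point p A (suc j) + point p′ B (suc j))
      ≡⟨ sumBelow-+ n _ _ ⟩
    sumBelow n (λ j → point p A (suc j)) + sumBelow n (λ j → point p′ B (suc j))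
      ≡⟨ cong₂ _+_ (sumBelow-point n 1≤p p≤n) (sumBelow-point n 1≤p′ p′≤n) ⟩
    A + B ∎

  runs-onlyTops : ∀ {m} → 1 ≤ m → m ≤ n → ∀ k → runs m onlyTops k ≡ 1
  runs-onlyTops _ _ zero = refl
  runs-onlyTops {m} 1≤m m≤n (suc k) = runs-step₁ k 1≤m m≤n next
    where
    next : ∀ b → runs m (step m onlyTops b) k ≡ point m 1 b
    next b with b ≟ m
    ... | yes _ = runs-onlyTops 1≤m m≤n k
    ... | no _  = runs-dead m k

  runs-tail : ∀ {p} → 1 ≤ p → suc p ≤ n → ∀ k → runs (suc p) tail k ≡ 1
  runs-tail _ _ zero = refl
  runs-tail {p} 1≤p m≤n (suc k) = runs-step₁ k 1≤p (<⇒≤ m≤n) next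
    where
    next : ∀ b → runs (suc p) (step (suc p) tail b) k ≡ point p 1 b
    next b with b ≟ p
    ... | yes _ = runs-tail 1≤p m≤n k
    ... | no _  = runs-dead (suc p) k

  runs-topsThenTail : ∀ {p} → 1 ≤ p → suc p ≤ n → ∀ k → runs (suc p) topsThenTail k ≡ suc k
  runs-topsThenTail _ _ zero = refl
  runs-topsThenTail {p} 1≤p m≤n (suc k) =
    trans (runs-step₂ k (s≤s z≤n) m≤n 1≤p (<⇒≤ m≤n) next) (+-comm (suc k) 1)
    where
    next : ∀ b → runs (suc p) (step (suc p) topsThenTail b) k ≡ point (suc p) (suc k) b + point p 1 b
    next b with b ≟ suc p | b ≟ p
    ... | yes refl | yes b≡p = ⊥-elim (<-irrefl (sym b≡p) (n<1+n p))
    ... | yes _    | no _    = trans (runs-topsThenTail 1≤p m≤n k) (sym (+-identityʳ (suc k)))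
    ... | no _     | yes _   = runs-tail 1≤p m≤n k
    ... | no _     | no _    = runs-dead (suc p) k

  runs-topNext : ∀ {p} → 1 ≤ p → suc p ≤ n → ∀ k → runs (suc p) topNext k ≡ k
  runs-topNext _ _ zero = refl
  runs-topNext {p} 1≤p m≤n (suc k) = runs-step₁ k (s≤s z≤n) m≤n next
    where
    next : ∀ b → runs (suc p) (step (suc p) topNext b) k ≡ point (suc p) (suc k) b
    next b with b ≟ suc p
    ... | yes _ = runs-topsThenTail 1≤p m≤n k
    ... | no _  = runs-dead (suc p) k

  runs-expecting : ∀ {m v} → 1 ≤ v → v < m → m ≤ n → ∀ k → runs m (expecting v) k ≡ k C suc (m ∸ v)
  runs-afterNew : ∀ {m v} → 1 ≤ v → v < m → m ≤ n → ∀ k → runs m (afterNew m v) k ≡ k C (m ∸ v)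

  runs-expecting _ _ _ zero = refl
  runs-expecting {m} {v} 1≤v v<m m≤n (suc k) =
    trans (runs-step₂ k (≤-trans (s≤s z≤n) v<m) m≤n 1≤v (≤-trans (<⇒≤ v<m) m≤n) next)
          (trans (+-comm (k C suc (m ∸ v)) _) (nCk+nC[k+1]≡[n+1]C[k+1] k (m ∸ v)))
    where
    next : ∀ b → runs m (step m (expecting v) b) k ≡ point m (k C suc (m ∸ v)) b + point v (k C (m ∸ v)) b
    next b with b ≟ m | b ≟ v
    ... | yes refl | yes refl = ⊥-elim (<-irrefl refl v<m)
    ... | yes _    | no _     = trans (runs-expecting 1≤v v<m m≤n k) (sym (+-identityʳ _))
    ... | no _     | yes _    = runs-afterNew 1≤v v<m m≤n k
    ... | no _     | no _     = runs-dead m k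

  runs-afterNew {m} {v} 1≤v v<m m≤n k with suc v ≟ m
  ... | yes refl = trans (runs-topNext 1≤v m≤n k) (sym (trans (cong (k C_) (m+n∸n≡m 1 v)) (nC1≡n k)))
  ... | no sv≢m =
    trans (runs-expecting (s≤s z≤n) sv<m m≤n k) (cong (k C_) (sym (+-∸-assoc 1 v<m)))
    where
    sv<m : suc v < m
    sv<m = ≤∧≢⇒< v<m sv≢m

firstLetterCount : ℕ → ℕ → ℕ
firstLetterCount k (suc zero) = 1
firstLetterCount k m          = k C m

runs-start : ∀ {n m} → 1 ≤ m → m ≤ n → ∀ k → Counting.runs n m (start m) k ≡ firstLetterCount k m
runs-start {n} {suc zero}    1≤m m≤n k = Counting.runs-onlyTops n 1≤m m≤n k
runs-start {n} {suc (suc _)} _   m≤n k = Counting.runs-expecting n (s≤s z≤n) (s≤s (s≤s z≤n)) m≤n k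

sum-firstLetterCount : ∀ N → sumBelow (suc N) (λ j → firstLetterCount N (suc j)) ≡ 2 ^ N ∸ suc N + 1
sum-firstLetterCount N = begin
  suc X                    ≡⟨ +-comm 1 X ⟩
  X + 1                    ≡⟨ cong (_+ 1) (sym (m+n∸m≡n (suc N) X)) ⟩
  suc N + X ∸ suc N + 1    ≡⟨ cong (λ t → t ∸ suc N + 1) all-binomials ⟩
  2 ^ N ∸ suc N + 1        ∎
  where
  X : ℕ
  X = sumBelow N (λ j → N C suc (suc j))

  all-binomials : suc N + X ≡ 2 ^ N
  all-binomials = trans (cong (λ t → suc (t + X)) (sym (nC1≡n N)))
                        (sumBelow-binomial N (suc (suc N)) (n≤1+n (suc N)))

wordsOver-positive : ∀ n k → All (All (1 ≤_)) (wordsOver n k)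
wordsOver-positive n zero    = [] ∷ []
wordsOver-positive n (suc k) =
  All.concat⁺ (All.map⁺ {xs = range1 n} (All.tabulate (λ a∈ →
    All.map⁺ (All.map (proj₁ (∈-range1⁻ a∈) ∷_) (wordsOver-positive n k)))))

filter-cong : ∀ {p q : List ℕ → Bool} {xs} → All (λ x → T (p x) ⇔ T (q x)) xs →
              filter (λ x → T? (p x)) xs ≡ filter (λ x → T? (q x)) xs
filter-cong [] = refl
filter-cong {p} {q} {x ∷ xs} (px⇔qx ∷ ⇔s) with p x | q x
... | true  | true  = cong (x ∷_) (filter-cong ⇔s)
... | false | false = filter-cong ⇔s
... | true  | false = ⊥-elim (to px⇔qx tt)
... | false | true  = ⊥-elim (from px⇔qx tt)

RAS321-count : ∀ {n m} → 1 ≤ m → m ≤ n → ∀ k →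
               length (filter (λ x → T? (RAS321 (m ∷ x))) (wordsOver n k)) ≡ firstLetterCount k m
RAS321-count {n} 1≤m m≤n k =
  trans (cong length (filter-cong (All.map (RAS321⇔accepts 1≤m) (wordsOver-positive n k))))
        (runs-start 1≤m m≤n k)

mainTheorem5 : (n : ℕ) → 1 ≤ n →
    length (RevAscAvoiding n (3 ∷ 2 ∷ 1 ∷ [])) ≡ 2 ^ (n ∸ 1) ∸ n + 1
mainTheorem5 (suc N) _ = begin
  length (RevAscAvoiding (suc N) σ321)
    ≡⟨ length-filter-wordsOver RAS321 (suc N) N ⟩
  sumBelow (suc N) (λ j → length (filter (λ x → T? (RAS321 (suc j ∷ x))) (wordsOver (suc N) N)))
    ≡⟨ sumBelow-cong (suc N) (λ j j<n → RAS321-count (s≤s z≤n) j<n N) ⟩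
  sumBelow (suc N) (λ j → firstLetterCount N (suc j))
    ≡⟨ sum-firstLetterCount N ⟩
  2 ^ N ∸ suc N + 1 ∎
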